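{- For $q\ge p\ge 2$, $\operatorname{Z}_+(K_{p,q})=p$ and $\overline{\operatorname{Z}}_+(K_{p,q})=q$. If $p\ge 3$ then $z^+_0(K_{p,q})=p+q-2$; consequently for $q=p\ge 4$, $z^+_0(K_{p,p})=2p-2=\overline{\operatorname{Z}}_+(K_{p,p})+p-2>\overline{\operatorname{Z}}_+(K_{p,p})+1$. For $q\ge 4$, $\underline{z^+_0}(K_{2,q})=3$ and $z^+_0(K_{2,q})=q+1$, so $z^+_0(K_{2,q})=\underline{z^+_0}(K_{2,q})+q-2>\underline{z^+_0}(K_{2,q})$.
   Context: All graphs are finite, simple, undirected. PSD color change rule: given the current set $B$ of blue vertices and $W=V(G)\setminus B$ of white vertices, let $W_1,\dots,W_k$ be the vertex sets of the components of $G[W]$; if $u\in B$, $w\in W_i$, and $w$ is the only white neighbor of $u$ in $G[W_i\cup B]$, then $u$ may turn $w$ blue. A PSD forcing set is a set $S$ such that starting with exactly $S$ blue, repeated application makes every vertex blue. $\operatorname{Z}_+(G)$ is the minimum size of a PSD forcing set and $\overline{\operatorname{Z}}_+(G)$ the maximum size of an inclusion-minimal PSD forcing set. The PSD TAR graph $\mathfrak{Z}^+(G)$ has the PSD forcing sets as vertices, two adjacent iff their symmetric difference has one element; $\mathfrak{Z}^+_k(G)$ is its subgraph induced by PSD forcing sets of size at most $k$. $\underline{z^+_0}(G)$ is the least $k$ with $\mathfrak{Z}^+_k(G)$ connected, and $z^+_0(G)$ is the least $k_0$ such that $\mathfrak{Z}^+_k(G)$ is connected for all $k\ge k_0$. $K_{p,q}$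 is the complete bipartite graph with parts of sizes $p$ and $q$. -}

module Defs where

open import Data.Nat using (ℕ; _≤_; _<_; _+_)
open import Data.Fin using (Fin; toℕ)
open import Data.Fin.Subset using (Subset; _∈_; _∉_; _⊂_; ∣_∣; inside; ⁅_⁆; _∪_)
open import Data.Vec using (lookup; _[_]≔_)
open import Data.Bool using (not)
open import Data.Product using (Σ; _×_; ∃)
open import Data.Sum using (_⊎_)
open import Relation.Binary.PropositionalEquality using (_≡_)
open import Relation.Nullary using (¬_)

Graph : ℕ → Set₁
Graph n = Fin n → Fin n → Set

K : (p q : ℕ) → Graph (p + q)
K p q x y = (toℕ x < p × p ≤ toℕ y) ⊎ (p ≤ toℕ x × toℕ y < p)

module _ {n : ℕ} (G : Graph n) where

  data SameWhiteComp (B : Subset n) : Fin n → Fin n → Set where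
    here : ∀ {x} → x ∉ B → SameWhiteComp B x x
    there : ∀ {x z y} → x ∉ B → G x z → SameWhiteComp B z y → SameWhiteComp B x y

  -- PSD color change rule: blue u forces white w, where w is the only white
  -- neighbour of u inside the component of G[W] containing w.
  PSDForce : Subset n → Fin n → Fin n → Set
  PSDForce B u w = u ∈ B × w ∉ B × G u w
    × (∀ w' → w' ∉ B → G u w' → SameWhiteComp B w w' → w' ≡ w)

  data PSDCompletes : Subset n → Set where
    done : ∀ {B} → (∀ v → v ∈ B) → PSDCompletes B
    step : ∀ {B} u w → PSDForce B u w → PSDCompletes (B ∪ ⁅ w ⁆) → PSDCompletes B

  IsPSDForcingSet : Subset n → Set
  IsPSDForcingSet S = PSDCompletes S

  IsMinimalPSDForcingSet : Subset n → Set
  IsMinimalPSDForcingSet S = IsPSDForcingSet S × (∀ T → T ⊂ S → ¬ IsPSDForcingSet T)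

  -- Adjacency in the TAR graph: symmetric difference is exactly one element.
  TARAdj : Subset n → Subset n → Set
  TARAdj S T = ∃ λ v → T ≡ S [ v ]≔ not (lookup S v)

  data TARPath (k : ℕ) : Subset n → Subset n → Set where
    stop : ∀ {S} → TARPath k S S
    move : ∀ {S S' T} → TARAdj S S' → IsPSDForcingSet S' → ∣ S' ∣ ≤ k
         → TARPath k S' T → TARPath k S T

  TARConnected : ℕ → Set
  TARConnected k = (∃ λ S → IsPSDForcingSet S × ∣ S ∣ ≤ k)
    × (∀ S T → IsPSDForcingSet S → ∣ S ∣ ≤ k → IsPSDForcingSet T → ∣ T ∣ ≤ k → TARPath k S T)

IsLeast : (ℕ → Set) → ℕ → Set
IsLeast P m = P m × (∀ k → P k → m ≤ k)

IsGreatest : (ℕ → Set) → ℕ → Set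
IsGreatest P m = P m × (∀ k → P k → k ≤ m)

module _ {n : ℕ} (G : Graph n) where

  ZPlusIs : ℕ → Set
  ZPlusIs = IsLeast (λ k → Σ (Subset n) λ S → IsPSDForcingSet G S × ∣ S ∣ ≡ k)

  ZPlusBarIs : ℕ → Set
  ZPlusBarIs = IsGreatest (λ k → Σ (Subset n) λ S → IsMinimalPSDForcingSet G S × ∣ S ∣ ≡ k)

  UnderZ0Is : ℕ → Set
  UnderZ0Is = IsLeast (TARConnected G)

  Z0Is : ℕ → Set
  Z0Is = IsLeast (λ k₀ → ∀ k → k₀ ≤ k → TARConnected G k)

-- Let P and Q be the parts of K_{p,q} and, for a set S of blue vertices, a = |S ∩ P|, b = |S ∩ Q|.
-- Once both parts contain a white vertex the white graph is connected, so a blue vertex can only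
-- force if it has a single white neighbour. Hence S is PSD forcing exactly when a = p, or b = q,
-- or one part has a single white vertex and the other part a blue one: forcing depends on (a, b)
-- alone, and a TAR move changes one of a, b by one. The part P is a minimum and Q a maximum
-- minimal forcing set (any forcing set of size > q has a removable vertex). For k ≥ p + q - 2
-- (and for k = 3 when p = 2) every forcing set of size ≤ k walks to P, adding vertices of P and,
-- when the size bound is tight, first dropping a vertex of Q. The lower bounds come from
-- invariants of (a, b) along walks: in 𝔷⁺_{p+q-3} no walk leads from a ≥ p - 1 to a ≤ p - 2, in
-- 𝔷⁺_q no walk leaves a = 0, and in 𝔷⁺_p the set P is isolated.

module Submission where

open import Defs
open import Data.Bool using (true; false; not)
open import Data.Bool.Properties using (∨-zeroʳ; ∨-identityʳ; not-involutive)
open import Data.Empty using (⊥-elim)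
open import Data.Fin using (Fin; zero; suc; toℕ) renaming (_≟_ to _≟ᶠ_)
open import Data.Fin.Subset
open import Data.Fin.Subset.Properties
open import Data.Nat using (ℕ; zero; suc; _+_; _∸_; _*_; _≤_; _<_; z≤n; s≤s)
open import Data.Nat.Properties
open import Data.Product using (∃; _×_; _,_; proj₁; proj₂)
open import Data.Sum using (_⊎_; inj₁; inj₂; [_,_])
open import Data.Vec using (_∷_; []; _++_; _[_]≔_; lookup; here; there)
open import Data.Vec.Properties
  using ([]≔-updates; []=⇒lookup; lookup⇒[]=; lookup∘update; lookup∘update′; []≔-idempotent; []≔-lookup)
open import Function using (_∘_)
open import Relation.Binary.PropositionalEquality
  using (_≡_; refl; sym; trans; cong; cong₂; subst; subst₂; ≢-sym; module ≡-Reasoning)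
open import Relation.Nullary using (¬_; yes; no; contradiction)

private variable
  n k : ℕ

-- Counting in subsets

module _ where

  private variable
    x y : Fin n
    p q : Subset n

  ∪⁅⁆≡[]≔inside : ∀ (p : Subset n) x → p ∪ ⁅ x ⁆ ≡ p [ x ]≔ inside
  ∪⁅⁆≡[]≔inside (b ∷ p) zero    = cong₂ _∷_ (∨-zeroʳ b) (∪-identityʳ p)
  ∪⁅⁆≡[]≔inside (b ∷ p) (suc x) = cong₂ _∷_ (∨-identityʳ b) (∪⁅⁆≡[]≔inside p x)

  ∈-[]≔inside⁺ : x ∈ p → x ∈ p [ y ]≔ inside
  ∈-[]≔inside⁺ {x = x} {p = p} {y = y} x∈p with x ≟ᶠ y
  ... | yes refl = []≔-updates p x
  ... | no x≢y   = lookup⇒[]= x _ (trans (lookup∘update′ x≢y p inside) ([]=⇒lookup x∈p))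

  ∈-[]≔inside⁻ : x ∈ p [ y ]≔ inside → x ∉ p → x ≡ y
  ∈-[]≔inside⁻ {x = x} {p = p} {y = y} x∈p′ x∉p with x ≟ᶠ y
  ... | yes x≡y = x≡y
  ... | no x≢y  =
    contradiction (lookup⇒[]= x p (trans (sym (lookup∘update′ x≢y p inside)) ([]=⇒lookup x∈p′))) x∉p

  ∉-[]≔outside : x ∉ p [ x ]≔ outside
  ∉-[]≔outside {x = x} {p = p} x∈p′ with trans (sym ([]=⇒lookup x∈p′)) ([]=⇒lookup ([]≔-updates p x))
  ... | ()

  ∣p∣≡∣p∩q∣+∣p∩∁q∣ : ∀ (p q : Subset n) → ∣ p ∣ ≡ ∣ p ∩ q ∣ + ∣ p ∩ ∁ q ∣
  ∣p∣≡∣p∩q∣+∣p∩∁q∣ []            []            = refl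
  ∣p∣≡∣p∩q∣+∣p∩∁q∣ (inside  ∷ p) (inside  ∷ q) = cong suc (∣p∣≡∣p∩q∣+∣p∩∁q∣ p q)
  ∣p∣≡∣p∩q∣+∣p∩∁q∣ (inside  ∷ p) (outside ∷ q) = trans (cong suc (∣p∣≡∣p∩q∣+∣p∩∁q∣ p q)) (sym (+-suc _ _))
  ∣p∣≡∣p∩q∣+∣p∩∁q∣ (outside ∷ p) (_       ∷ q) = ∣p∣≡∣p∩q∣+∣p∩∁q∣ p q

  Empty⇒∣p∣≡0 : ∀ {n} {p : Subset n} → Empty p → ∣ p ∣ ≡ 0
  Empty⇒∣p∣≡0 {n} ¬ne = trans (cong ∣_∣ (Empty-unique ¬ne)) (∣⊥∣≡0 n)

  0<∣p∣⇒Nonempty : ∀ {n} {p : Subset n} → 0 < ∣ p ∣ → Nonempty p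
  0<∣p∣⇒Nonempty {p = p} 0<∣p∣ with nonempty? p
  ... | yes ne  = ne
  ... | no  ¬ne = contradiction (Empty⇒∣p∣≡0 ¬ne) (≢-sym (<⇒≢ 0<∣p∣))

  x∈p⇒0<∣p∣ : x ∈ p → 0 < ∣ p ∣
  x∈p⇒0<∣p∣ {x = x} x∈p =
    subst (_≤ _) (∣⁅x⁆∣≡1 x) (p⊆q⇒∣p∣≤∣q∣ (λ y∈⁅x⁆ → subst (_∈ _) (sym (x∈⁅y⁆⇒x≡y x y∈⁅x⁆)) x∈p))

  ∣q∩∁p∣≡0⇒∣p∩q∣≡∣q∣ : ∀ (p q : Subset n) → ∣ q ∩ ∁ p ∣ ≡ 0 → ∣ p ∩ q ∣ ≡ ∣ q ∣
  ∣q∩∁p∣≡0⇒∣p∩q∣≡∣q∣ p q ∣q∩∁p∣≡0 = begin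
    ∣ p ∩ q ∣                ≡⟨ cong ∣_∣ (∩-comm p q) ⟩
    ∣ q ∩ p ∣                ≡⟨ +-identityʳ _ ⟨
    ∣ q ∩ p ∣ + 0            ≡⟨ cong (∣ q ∩ p ∣ +_) ∣q∩∁p∣≡0 ⟨
    ∣ q ∩ p ∣ + ∣ q ∩ ∁ p ∣  ≡⟨ ∣p∣≡∣p∩q∣+∣p∩∁q∣ q p ⟨
    ∣ q ∣                    ∎
    where open ≡-Reasoning

  x∈q∉p⇒∣p∩q∣<∣q∣ : x ∈ q → x ∉ p → ∣ p ∩ q ∣ < ∣ q ∣
  x∈q∉p⇒∣p∩q∣<∣q∣ {q = q} {p = p} x∈q x∉p = begin-strict
    ∣ p ∩ q ∣                  ≡⟨ cong ∣_∣ (∩-comm p q) ⟩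
    ∣ q ∩ p ∣                  <⟨ m<m+n _ (x∈p⇒0<∣p∣ (x∈p∩q⁺ (x∈q , x∉p⇒x∈∁p x∉p))) ⟩
    ∣ q ∩ p ∣ + ∣ q ∩ ∁ p ∣    ≡⟨ ∣p∣≡∣p∩q∣+∣p∩∁q∣ q p ⟨
    ∣ q ∣                      ∎
    where open ≤-Reasoning

  ∣p∩q∣<∣q∣⇒∃∈q∉p : ∀ {n} {p q : Subset n} → ∣ p ∩ q ∣ < ∣ q ∣ → ∃ λ x → x ∈ q × x ∉ p
  ∣p∩q∣<∣q∣⇒∃∈q∉p {p = p} {q} ∣p∩q∣<∣q∣
    with 0<∣p∣⇒Nonempty (n≢0⇒n>0 λ ∣q∩∁p∣≡0 → <-irrefl (∣q∩∁p∣≡0⇒∣p∩q∣≡∣q∣ p q ∣q∩∁p∣≡0) ∣p∩q∣<∣q∣)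
  ... | x , x∈q∩∁p with x∈p∩q⁻ q (∁ p) x∈q∩∁p
  ... | x∈q , x∈∁p = x , x∈q , x∈∁p⇒x∉p x∈∁p

  q⊆p⇒∣p∩q∣≡∣q∣ : q ⊆ p → ∣ p ∩ q ∣ ≡ ∣ q ∣
  q⊆p⇒∣p∩q∣≡∣q∣ {q = q} {p = p} q⊆p = ∣q∩∁p∣≡0⇒∣p∩q∣≡∣q∣ p q (Empty⇒∣p∣≡0 λ (x , x∈q∩∁p) →
    let x∈q , x∈∁p = x∈p∩q⁻ q (∁ p) x∈q∩∁p in x∈∁p⇒x∉p x∈∁p (q⊆p x∈q))

  ∣p∩q∣≡∣q∣⇒q⊆p : ∀ {n} {p q : Subset n} → ∣ p ∩ q ∣ ≡ ∣ q ∣ → q ⊆ p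
  ∣p∩q∣≡∣q∣⇒q⊆p {p = p} eq {x} x∈q with x ∈? p
  ... | yes x∈p = x∈p
  ... | no  x∉p = contradiction eq (<⇒≢ (x∈q∉p⇒∣p∩q∣<∣q∣ x∈q x∉p))

  ∣p[x]≔inside∩q∣ : x ∈ q → x ∉ p → ∣ (p [ x ]≔ inside) ∩ q ∣ ≡ suc ∣ p ∩ q ∣
  ∣p[x]≔inside∩q∣ {p = inside  ∷ p} here        x∉p = contradiction here x∉p
  ∣p[x]≔inside∩q∣ {p = outside ∷ p} here        x∉p = refl
  ∣p[x]≔inside∩q∣ {q = inside ∷ q} {p = inside ∷ p} (there x∈q) x∉p =
    cong suc (∣p[x]≔inside∩q∣ x∈q (drop-not-there x∉p))
  ∣p[x]≔inside∩q∣ {q = outside ∷ q} {p = inside ∷ p} (there x∈q) x∉p =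
    ∣p[x]≔inside∩q∣ x∈q (drop-not-there x∉p)
  ∣p[x]≔inside∩q∣ {p = outside ∷ p} (there x∈q) x∉p =
    ∣p[x]≔inside∩q∣ x∈q (drop-not-there x∉p)

  ∣p[x]≔outside∩q∣ : x ∈ q → x ∈ p → suc ∣ (p [ x ]≔ outside) ∩ q ∣ ≡ ∣ p ∩ q ∣
  ∣p[x]≔outside∩q∣ here here = refl
  ∣p[x]≔outside∩q∣ {q = inside ∷ q} {p = inside ∷ p} (there x∈q) (there x∈p) =
    cong suc (∣p[x]≔outside∩q∣ x∈q x∈p)
  ∣p[x]≔outside∩q∣ {q = outside ∷ q} {p = inside ∷ p} (there x∈q) (there x∈p) =
    ∣p[x]≔outside∩q∣ x∈q x∈p
  ∣p[x]≔outside∩q∣ {p = outside ∷ p} (there x∈q) (there x∈p) =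
    ∣p[x]≔outside∩q∣ x∈q x∈p

  ∣p[x]≔b∩q∣ : ∀ (p : Subset n) b → x ∉ q → ∣ (p [ x ]≔ b) ∩ q ∣ ≡ ∣ p ∩ q ∣
  ∣p[x]≔b∩q∣ {x = zero} {q = inside ∷ q} _ _ x∉q = contradiction here x∉q
  ∣p[x]≔b∩q∣ {x = zero} {q = outside ∷ q} (c ∷ p) b x∉q with b | c
  ... | inside  | inside  = refl
  ... | inside  | outside = refl
  ... | outside | inside  = refl
  ... | outside | outside = refl
  ∣p[x]≔b∩q∣ {x = suc x} {q = inside ∷ q} (inside ∷ p) b x∉q =
    cong suc (∣p[x]≔b∩q∣ p b (drop-not-there x∉q))
  ∣p[x]≔b∩q∣ {x = suc x} {q = outside ∷ q} (inside ∷ p) b x∉q =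
    ∣p[x]≔b∩q∣ p b (drop-not-there x∉q)
  ∣p[x]≔b∩q∣ {x = suc x} {q = _ ∷ q} (outside ∷ p) b x∉q =
    ∣p[x]≔b∩q∣ p b (drop-not-there x∉q)

  unique-∉⇒suc∣p∩q∣≡∣q∣ : x ∈ q → x ∉ p → (∀ {y} → y ∈ q → y ∉ p → y ≡ x) → suc ∣ p ∩ q ∣ ≡ ∣ q ∣
  unique-∉⇒suc∣p∩q∣≡∣q∣ {x = x} {q = q} {p = p} x∈q x∉p unique =
    trans (sym (∣p[x]≔inside∩q∣ x∈q x∉p)) (q⊆p⇒∣p∩q∣≡∣q∣ q⊆p′)
    where
    q⊆p′ : q ⊆ p [ x ]≔ inside
    q⊆p′ {y} y∈q with y ∈? p
    ... | yes y∈p = ∈-[]≔inside⁺ y∈p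
    ... | no  y∉p = subst (_∈ p [ x ]≔ inside) (sym (unique y∈q y∉p)) ([]≔-updates p x)

  suc∣p∩q∣≡∣q∣⇒unique-∉ : suc ∣ p ∩ q ∣ ≡ ∣ q ∣ → x ∈ q → x ∉ p → y ∈ q → y ∉ p → y ≡ x
  suc∣p∩q∣≡∣q∣⇒unique-∉ eq x∈q x∉p y∈q y∉p =
    ∈-[]≔inside⁻ (∣p∩q∣≡∣q∣⇒q⊆p (trans (∣p[x]≔inside∩q∣ x∈q x∉p) eq) y∈q) y∉p

-- Moves in the TAR graph

data Flip {n} (S : Subset n) : Subset n → Set where
  add    : ∀ {v} → v ∉ S → Flip S (S [ v ]≔ inside)
  remove : ∀ {v} → v ∈ S → Flip S (S [ v ]≔ outside)

Flip-shrinks⇒⊂ : ∀ {S T : Subset n} → Flip S T → ∣ T ∣ < ∣ S ∣ → T ⊂ S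
Flip-shrinks⇒⊂ {S = S} (add {v} v∉S) ∣T∣<∣S∣ =
  contradiction (p⊆q⇒∣p∣≤∣q∣ {p = S} {q = S [ v ]≔ inside} ∈-[]≔inside⁺) (<⇒≱ ∣T∣<∣S∣)
Flip-shrinks⇒⊂ {S = S} (remove {v} v∈S) _ = T⊆S , v , v∈S , ∉-[]≔outside
  where
  T⊆S : S [ v ]≔ outside ⊆ S
  T⊆S {x} x∈T with x ≟ᶠ v
  ... | yes refl = contradiction x∈T ∉-[]≔outside
  ... | no x≢v   = lookup⇒[]= x S (trans (sym (lookup∘update′ x≢v S outside)) ([]=⇒lookup x∈T))

module _ {n} (G : Graph n) where

  TARAdj⇒Flip : ∀ {S T} → TARAdj G S T → Flip S T
  TARAdj⇒Flip {S} (v , refl) with lookup S v in eq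
  ... | true  = remove (lookup⇒[]= v S eq)
  ... | false = add (λ v∈S → contradiction (trans (sym eq) ([]=⇒lookup v∈S)) λ ())

  Flip⇒TARAdj : ∀ {S T} → Flip S T → TARAdj G S T
  Flip⇒TARAdj {S} (add {v} v∉S) = v , cong (λ b → S [ v ]≔ not b) (sym lookup≡false)
    where
    lookup≡false : lookup S v ≡ false
    lookup≡false with lookup S v in eq
    ... | true  = contradiction (lookup⇒[]= v S eq) v∉S
    ... | false = refl
  Flip⇒TARAdj {S} (remove {v} v∈S) = v , cong (λ b → S [ v ]≔ not b) (sym ([]=⇒lookup v∈S))

  TARAdj-sym : ∀ {S T} → TARAdj G S T → TARAdj G T S
  TARAdj-sym {S} (v , refl) = v , sym (begin
    S′ [ v ]≔ not (lookup S′ v)  ≡⟨ cong (λ b → S′ [ v ]≔ not b) (lookup∘update v S _) ⟩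
    S′ [ v ]≔ not (not (lookup S v)) ≡⟨ cong (S′ [ v ]≔_) (not-involutive _) ⟩
    S′ [ v ]≔ lookup S v          ≡⟨ []≔-idempotent S v ⟩
    S [ v ]≔ lookup S v           ≡⟨ []≔-lookup S v ⟩
    S                             ∎)
    where
    open ≡-Reasoning
    S′ = S [ v ]≔ not (lookup S v)

  SameWhiteComp⇒∉ : ∀ {B x y} → SameWhiteComp G B x y → x ∉ B
  SameWhiteComp⇒∉ (here x∉B)      = x∉B
  SameWhiteComp⇒∉ (there x∉B _ _) = x∉B

  force-step : ∀ {B u w} → PSDForce G B u w → IsPSDForcingSet G (B [ w ]≔ inside) → IsPSDForcingSet G B
  force-step {B} {u} {w} force completes =
    step u w force (subst (PSDCompletes G) (sym (∪⁅⁆≡[]≔inside B w)) completes)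

  TARPath-++ : ∀ {S T R} → TARPath G k S T → TARPath G k T R → TARPath G k S R
  TARPath-++ stop                    path′ = path′
  TARPath-++ (move adj fT ∣T∣≤k path) path′ = move adj fT ∣T∣≤k (TARPath-++ path path′)

  TARPath-reverse : ∀ {S T} → IsPSDForcingSet G S → ∣ S ∣ ≤ k → TARPath G k S T → TARPath G k T S
  TARPath-reverse fS ∣S∣≤k path = reverse-onto fS ∣S∣≤k path stop
    where
    reverse-onto : ∀ {S T R} → IsPSDForcingSet G S → ∣ S ∣ ≤ k →
      TARPath G k S T → TARPath G k S R → TARPath G k T R
    reverse-onto _  _     stop                      back = back
    reverse-onto fS ∣S∣≤k (move adj fT ∣T∣≤k path) back =
      reverse-onto fT ∣T∣≤k path (move (TARAdj-sym adj) fS ∣S∣≤k back)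

  hub⇒TARConnected : ∀ {H} → IsPSDForcingSet G H → ∣ H ∣ ≤ k →
    (∀ {S} → IsPSDForcingSet G S → ∣ S ∣ ≤ k → TARPath G k S H) → TARConnected G k
  hub⇒TARConnected fH ∣H∣≤k toHub =
    (_ , fH , ∣H∣≤k) ,
    λ _ _ fS ∣S∣≤k fT ∣T∣≤k → TARPath-++ (toHub fS ∣S∣≤k) (TARPath-reverse fT ∣T∣≤k (toHub fT ∣T∣≤k))

  TARInvariant : ℕ → (Subset n → Set) → Set
  TARInvariant k I = ∀ {S T} → TARAdj G S T →
    IsPSDForcingSet G S → ∣ S ∣ ≤ k → IsPSDForcingSet G T → ∣ T ∣ ≤ k → I S → I T

  TARPath-preserves : ∀ {I S T} → TARInvariant k I →
    IsPSDForcingSet G S → ∣ S ∣ ≤ k → TARPath G k S T → I S → I T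
  TARPath-preserves inv _  _     stop                      IS = IS
  TARPath-preserves inv fS ∣S∣≤k (move adj fT ∣T∣≤k path) IS =
    TARPath-preserves inv fT ∣T∣≤k path (inv adj fS ∣S∣≤k fT ∣T∣≤k IS)

  TARInvariant⇒¬TARConnected : ∀ {I S T} → TARInvariant k I →
    IsPSDForcingSet G S → ∣ S ∣ ≤ k → I S → IsPSDForcingSet G T → ∣ T ∣ ≤ k → ¬ I T → ¬ TARConnected G k
  TARInvariant⇒¬TARConnected {S = S} {T} inv fS ∣S∣≤k IS fT ∣T∣≤k ¬IT (_ , connected) =
    ¬IT (TARPath-preserves inv fS ∣S∣≤k (connected S T fS ∣S∣≤k fT ∣T∣≤k) IS)

  Z0Is-suc : ∀ {m} → (∀ k → suc m ≤ k → TARConnected G k) → ¬ TARConnected G m → Z0Is G (suc m)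
  Z0Is-suc connected ¬connected =
    connected , λ _ connected-from → ≰⇒> λ k₀≤m → ¬connected (connected-from _ k₀≤m)

  UnderZ0Is-intro : ∀ {m} → TARConnected G m → (∀ {k} → k < m → ¬ TARConnected G k) → UnderZ0Is G m
  UnderZ0Is-intro connected ¬connected =
    connected , λ _ connected-at → ≮⇒≥ λ k<m → ¬connected k<m connected-at

-- Forcing count pairs

module _ where

  private variable
    p q a b : ℕ

  -- a and b count the blue vertices in two parts of sizes p and q.
  data ForcingCounts (p q a b : ℕ) : Set where
    left-full         : a ≡ p → ForcingCounts p q a b
    right-full        : b ≡ q → ForcingCounts p q a b
    right-almost-full : suc b ≡ q → 0 < a → ForcingCounts p q a b
    left-almost-full  : suc a ≡ p → 0 < b → ForcingCounts p q a b

  ForcingCounts-swap : ForcingCounts p q a b → ForcingCounts q p b a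
  ForcingCounts-swap (left-full a≡p)              = right-full a≡p
  ForcingCounts-swap (right-full b≡q)             = left-full b≡q
  ForcingCounts-swap (right-almost-full 1+b≡q 0<a) = left-almost-full 1+b≡q 0<a
  ForcingCounts-swap (left-almost-full 1+a≡p 0<b)  = right-almost-full 1+a≡p 0<b

  ForcingCounts-suc-left : a < p → ForcingCounts p q a b → ForcingCounts p q (suc a) b
  ForcingCounts-suc-left a<p (left-full refl)           = contradiction a<p (<-irrefl refl)
  ForcingCounts-suc-left _   (right-full b≡q)           = right-full b≡q
  ForcingCounts-suc-left _   (right-almost-full 1+b≡q _) = right-almost-full 1+b≡q (s≤s z≤n)
  ForcingCounts-suc-left _   (left-almost-full 1+a≡p _)  = left-full 1+a≡p

  ForcingCounts⇒p≤a+b : p ≤ q → ForcingCounts p q a b → p ≤ a + b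
  ForcingCounts⇒p≤a+b {b = b} _   (left-full refl)               = m≤m+n _ b
  ForcingCounts⇒p≤a+b {a = a} p≤q (right-full refl)              = ≤-trans p≤q (m≤n+m _ a)
  ForcingCounts⇒p≤a+b {b = b} p≤q (right-almost-full refl 0<a)   = ≤-trans p≤q (+-monoˡ-≤ b 0<a)
  ForcingCounts⇒p≤a+b {a = a} {b} _ (left-almost-full refl 0<b) =
    subst (_≤ a + b) (+-comm a 1) (+-monoʳ-≤ a 0<b)

  ¬ForcingCounts-left-empty : 2 ≤ p → b < q → ¬ ForcingCounts p q 0 b
  ¬ForcingCounts-left-empty 2≤p _   (left-full refl)          = contradiction 2≤p λ ()
  ¬ForcingCounts-left-empty _   b<q (right-full refl)         = <-irrefl refl b<q
  ¬ForcingCounts-left-empty 2≤p _   (left-almost-full refl _) = contradiction 2≤p λ { (s≤s ()) }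

  ForcingCounts-removable : p ≤ q → q < a + b → ForcingCounts p q a b →
    (∃ λ a′ → a ≡ suc a′ × ForcingCounts p q a′ b) ⊎ (∃ λ b′ → b ≡ suc b′ × ForcingCounts p q a b′)
  ForcingCounts-removable {b = zero}  p≤q q<p+0 (left-full refl) =
    contradiction (subst (_ <_) (+-identityʳ _) q<p+0) (≤⇒≯ p≤q)
  ForcingCounts-removable {b = suc b} _ _ (left-full refl) = inj₂ (b , refl , left-full refl)
  ForcingCounts-removable {a = zero}  _ q<0+q (right-full refl) = contradiction q<0+q (<-irrefl refl)
  ForcingCounts-removable {a = suc a} _ _ (right-full refl) = inj₁ (a , refl , right-full refl)
  ForcingCounts-removable {a = suc zero} _ (s≤s b<b) (right-almost-full refl _) =
    contradiction b<b (<-irrefl refl)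
  ForcingCounts-removable {a = suc (suc a)} _ _ (right-almost-full refl _) =
    inj₁ (suc a , refl , right-almost-full refl (s≤s z≤n))
  ForcingCounts-removable {a = a} {b = suc zero} p≤q q<a+1 (left-almost-full refl _) =
    contradiction (≤-trans (s≤s p≤q) q<a+1) (<-irrefl (+-comm 1 a))
  ForcingCounts-removable {b = suc (suc b)} _ _ (left-almost-full refl _) =
    inj₂ (suc b , refl , left-almost-full refl (s≤s z≤n))

  data CountStep (p q : ℕ) : ℕ → ℕ → ℕ → ℕ → Set where
    addˡ  : a < p → CountStep p q a b (suc a) b
    dropˡ : CountStep p q (suc a) b a b
    addʳ  : b < q → CountStep p q a b a (suc b)
    dropʳ : CountStep p q a (suc b) a b

  CountStep-cast : ∀ {a₁ b₁ a₁′ b₁′ a₂ b₂ a₂′ b₂′} → a₁ ≡ a₂ → b₁ ≡ b₂ → a₁′ ≡ a₂′ → b₁′ ≡ b₂′ →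
    CountStep p q a₁ b₁ a₁′ b₁′ → CountStep p q a₂ b₂ a₂′ b₂′
  CountStep-cast refl refl refl refl count-step = count-step

  CountInvariant : (p q k : ℕ) → (ℕ → ℕ → Set) → Set
  CountInvariant p q k I = ∀ {a b a′ b′} → CountStep p q a b a′ b′ →
    ForcingCounts p q a b → a + b ≤ k → ForcingCounts p q a′ b′ → a′ + b′ ≤ k → I a b → I a′ b′

  left-full-invariant : 2 ≤ q → k ≤ p → CountInvariant p q k (λ a _ → a ≡ p)
  left-full-invariant _ _ (addˡ a<p) _ _ _ _ refl = contradiction a<p (<-irrefl refl)
  left-full-invariant 2≤q k≤p (dropˡ {a} {b}) _ a+b≤k fc _ refl
    with n≤0⇒n≡0 (+-cancelˡ-≤ (suc a) b 0 (subst (suc a + b ≤_) (sym (+-identityʳ _)) (≤-trans a+b≤k k≤p)))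
  ... | refl = ⊥-elim (¬fc fc)
    where
    ¬fc : ¬ ForcingCounts (suc a) _ a 0
    ¬fc (left-full a≡1+a)          = <-irrefl a≡1+a ≤-refl
    ¬fc (right-full refl)          = contradiction 2≤q λ ()
    ¬fc (right-almost-full refl _) = contradiction 2≤q λ { (s≤s ()) }
  left-full-invariant _ _ (addʳ _) _ _ _ _ a≡p = a≡p
  left-full-invariant _ _ dropʳ    _ _ _ _ a≡p = a≡p

  left-empty-invariant : 2 ≤ p → k ≤ q → CountInvariant p q k (λ a _ → a ≡ 0)
  left-empty-invariant 2≤p _ (addˡ _) (left-full refl) _ _ _ refl = contradiction 2≤p λ ()
  left-empty-invariant _ k≤q (addˡ _) (right-full refl) _ _ a′+b′≤k refl =
    contradiction (≤-trans a′+b′≤k k≤q) (<-irrefl refl)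
  left-empty-invariant 2≤p _ (addˡ _) (left-almost-full refl _) _ _ _ refl = contradiction 2≤p λ { (s≤s ()) }
  left-empty-invariant _ _ dropˡ    _ _ _ _ ()
  left-empty-invariant _ _ (addʳ _) _ _ _ _ a≡0 = a≡0
  left-empty-invariant _ _ dropʳ    _ _ _ _ a≡0 = a≡0

  left-almost-full-invariant : 3 + k ≤ p + q → CountInvariant p q k (λ a _ → p ≤ suc a)
  left-almost-full-invariant _ (addˡ _) _ _ _ _ p≤1+a = m≤n⇒m≤1+n p≤1+a
  left-almost-full-invariant {k} {p} {q} 3+k≤p+q (dropˡ {a} {b}) _ a+b≤k fc _ p≤2+a with p ≤? suc a
  ... | yes p≤1+a = p≤1+a
  ... | no  p≰1+a with ≤-antisym p≤2+a (≰⇒> p≰1+a)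
  ...   | refl = ⊥-elim (¬fc fc)
    where
    room : suc (suc b) ≤ q
    room = +-cancelˡ-≤ a (suc (suc b)) q
      (subst (_≤ a + q) (sym (trans (+-suc a (suc b)) (cong suc (+-suc a b))))
        (≤-pred (≤-pred (≤-trans (s≤s (s≤s (s≤s a+b≤k))) 3+k≤p+q))))
    ¬fc : ¬ ForcingCounts (suc (suc a)) q a b
    ¬fc (left-full a≡2+a)           = <-irrefl a≡2+a (m<n⇒m<1+n (n<1+n a))
    ¬fc (right-full b≡q)            = <-irrefl b≡q (≤-trans (n≤1+n _) room)
    ¬fc (right-almost-full 1+b≡q _) = <-irrefl 1+b≡q room
    ¬fc (left-almost-full 1+a≡2+a _) = <-irrefl 1+a≡2+a (n<1+n _)
  left-almost-full-invariant _ (addʳ _) _ _ _ _ p≤1+a = p≤1+a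
  left-almost-full-invariant _ dropʳ    _ _ _ _ p≤1+a = p≤1+a

  Shrinkable : (p q k : ℕ) → Set
  Shrinkable p q k = ∀ {a b} → a < p → a + b ≡ k → ForcingCounts p q a b →
    ∃ λ b′ → b ≡ suc b′ × ForcingCounts p q a b′

  shrinkable : p ≤ q → 3 ≤ q → q < k → p + q ≤ 2 + k → Shrinkable p q k
  shrinkable _ _ _ _ a<p _ (left-full refl) = contradiction a<p (<-irrefl refl)
  shrinkable {q = suc q} _ _ q<k _ {a} _ refl (right-full refl) =
    q , refl , right-almost-full refl (+-cancelʳ-< (suc q) 0 a q<k)
  shrinkable {p} _ (s≤s (s≤s 0<b)) _ p+q≤2+k {a} {suc b} a<p refl (right-almost-full refl _) =
    b , refl , left-almost-full (≤-antisym a<p p≤1+a) 0<b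
    where
    p≤1+a : p ≤ suc a
    p≤1+a = +-cancelʳ-≤ b p (suc a) (≤-pred (≤-pred (begin
      suc (suc (p + b))   ≡⟨ cong suc (+-suc p b) ⟨
      suc (p + suc b)     ≡⟨ +-suc p (suc b) ⟨
      p + suc (suc b)     ≤⟨ p+q≤2+k ⟩
      2 + (a + suc b)     ≡⟨ cong (2 +_) (+-suc a b) ⟩
      2 + (suc a + b)     ∎)))
      where open ≤-Reasoning
  shrinkable p≤q _ q<k _ {a} {suc zero} _ refl (left-almost-full refl _) =
    contradiction (≤-trans (s≤s p≤q) q<k) (<-irrefl (+-comm 1 a))
  shrinkable _ _ _ _ {b = suc (suc b)} _ refl (left-almost-full refl _) =
    suc b , refl , left-almost-full refl (s≤s z≤n)

  shrinkable-2-3 : 4 ≤ q → Shrinkable 2 q 3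
  shrinkable-2-3 _   {zero}  _ refl (left-full ())
  shrinkable-2-3 4≤3 {zero}  _ refl (right-full refl) = contradiction 4≤3 λ { (s≤s (s≤s (s≤s ()))) }
  shrinkable-2-3 _   {zero}  _ refl (right-almost-full _ ())
  shrinkable-2-3 _   {zero}  _ refl (left-almost-full () _)
  shrinkable-2-3 _   {suc zero} _ refl _ = 1 , refl , left-almost-full refl (s≤s z≤n)
  shrinkable-2-3 _   {suc (suc _)} (s≤s (s≤s ())) _ _

-- Complete bipartite graphs

record IsCompleteBipartite {n} (G : Graph n) (P Q : Subset n) : Set where
  field
    partition     : ∀ x → x ∈ P ⊎ x ∈ Q
    disjoint      : ∀ {x} → x ∈ P → x ∉ Q
    P→Q-edge      : ∀ {x y} → x ∈ P → y ∈ Q → G x y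
    Q→P-edge      : ∀ {x y} → x ∈ Q → y ∈ P → G x y
    P-independent : ∀ {x y} → x ∈ P → y ∈ P → ¬ G x y
    Q-independent : ∀ {x y} → x ∈ Q → y ∈ Q → ¬ G x y

  disjoint′ : ∀ {x} → x ∈ Q → x ∉ P
  disjoint′ x∈Q x∈P = disjoint x∈P x∈Q

  P-neighbour : ∀ {x y} → x ∈ P → G x y → y ∈ Q
  P-neighbour {y = y} x∈P adj with partition y
  ... | inj₁ y∈P = contradiction adj (P-independent x∈P y∈P)
  ... | inj₂ y∈Q = y∈Q

  Q-neighbour : ∀ {x y} → x ∈ Q → G x y → y ∈ P
  Q-neighbour {y = y} x∈Q adj with partition y
  ... | inj₁ y∈P = y∈P
  ... | inj₂ y∈Q = contradiction adj (Q-independent x∈Q y∈Q)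

  ⊆Q⇒∣S∩P∣≡0 : ∀ {S} → S ⊆ Q → ∣ S ∩ P ∣ ≡ 0
  ⊆Q⇒∣S∩P∣≡0 {S} S⊆Q = Empty⇒∣p∣≡0 λ (x , x∈S∩P) →
    let x∈S , x∈P = x∈p∩q⁻ S P x∈S∩P in disjoint x∈P (S⊆Q x∈S)

  ⊆P⇒∣S∩Q∣≡0 : ∀ {S} → S ⊆ P → ∣ S ∩ Q ∣ ≡ 0
  ⊆P⇒∣S∩Q∣≡0 {S} S⊆P = Empty⇒∣p∣≡0 λ (x , x∈S∩Q) →
    let x∈S , x∈Q = x∈p∩q⁻ S Q x∈S∩Q in disjoint (S⊆P x∈S) x∈Q

  ∣S∣≡∣S∩P∣+∣S∩Q∣ : ∀ S → ∣ S ∣ ≡ ∣ S ∩ P ∣ + ∣ S ∩ Q ∣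
  ∣S∣≡∣S∩P∣+∣S∩Q∣ S = trans (∣p∣≡∣p∩q∣+∣p∩∁q∣ S P) (cong (λ R → ∣ S ∩ P ∣ + ∣ S ∩ R ∣) (sym Q≡∁P))
    where
    Q≡∁P : Q ≡ ∁ P
    Q≡∁P = ⊆-antisym (λ x∈Q → x∉p⇒x∈∁p (disjoint′ x∈Q)) λ {x} x∈∁P →
      [ (λ x∈P → contradiction x∈P (x∈∁p⇒x∉p x∈∁P)) , (λ x∈Q → x∈Q) ] (partition x)

IsCompleteBipartite-swap : ∀ {n} {G : Graph n} {P Q} → IsCompleteBipartite G P Q → IsCompleteBipartite G Q P
IsCompleteBipartite-swap bip = record
  { partition     = λ x → [ inj₂ , inj₁ ] (partition x)
  ; disjoint      = disjoint′
  ; P→Q-edge      = Q→P-edge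
  ; Q→P-edge      = P→Q-edge
  ; P-independent = Q-independent
  ; Q-independent = P-independent
  }
  where open IsCompleteBipartite bip

module OneSide {n} {G : Graph n} {P Q : Subset n} (bip : IsCompleteBipartite G P Q) where

  open IsCompleteBipartite bip

  white-component-of-Q : ∀ {S w w′} → P ⊆ S → w ∈ Q → SameWhiteComp G S w w′ → w′ ≡ w
  white-component-of-Q _   _   (here _)           = refl
  white-component-of-Q P⊆S w∈Q (there _ adj rest) =
    contradiction (P⊆S (Q-neighbour w∈Q adj)) (SameWhiteComp⇒∉ G rest)

  left-full⇒forcing : Nonempty P → ∀ {S} → ∣ S ∩ P ∣ ≡ ∣ P ∣ → IsPSDForcingSet G S
  left-full⇒forcing (u , u∈P) {S} a≡p =
    fill-Q (∣ Q ∣ ∸ ∣ S ∩ Q ∣) (∣p∩q∣≡∣q∣⇒q⊆p a≡p) (m+[n∸m]≡n (∣p∩q∣≤∣q∣ S Q))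
    where
    fill-Q : ∀ m {S} → P ⊆ S → ∣ S ∩ Q ∣ + m ≡ ∣ Q ∣ → IsPSDForcingSet G S
    fill-Q zero P⊆S b≡q = done λ x →
      [ P⊆S , ∣p∩q∣≡∣q∣⇒q⊆p (trans (sym (+-identityʳ _)) b≡q) ] (partition x)
    fill-Q (suc m) {S} P⊆S b+1+m≡q with ∣p∩q∣<∣q∣⇒∃∈q∉p (subst (∣ S ∩ Q ∣ <_) b+1+m≡q (m<m+n _ (s≤s z≤n)))
    ... | w , w∈Q , w∉S =
      force-step G (P⊆S u∈P , w∉S , P→Q-edge u∈P w∈Q , λ _ _ _ → white-component-of-Q P⊆S w∈Q)
        (fill-Q m (λ x∈P → ∈-[]≔inside⁺ (P⊆S x∈P))
           (trans (cong (_+ m) (∣p[x]≔inside∩q∣ w∈Q w∉S)) (trans (sym (+-suc _ m)) b+1+m≡q)))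

  right-almost-full⇒forcing : (∀ {T} → ∣ T ∩ Q ∣ ≡ ∣ Q ∣ → IsPSDForcingSet G T) →
    ∀ {S} → suc ∣ S ∩ Q ∣ ≡ ∣ Q ∣ → 0 < ∣ S ∩ P ∣ → IsPSDForcingSet G S
  right-almost-full⇒forcing right-full⇒forcing {S} 1+b≡q 0<a
    with 0<∣p∣⇒Nonempty 0<a | ∣p∩q∣<∣q∣⇒∃∈q∉p (≤-reflexive 1+b≡q)
  ... | u , u∈S∩P | w , w∈Q , w∉S with x∈p∩q⁻ S P u∈S∩P
  ... | u∈S , u∈P =
    force-step G (u∈S , w∉S , P→Q-edge u∈P w∈Q , only-white)
      (right-full⇒forcing (trans (∣p[x]≔inside∩q∣ w∈Q w∉S) 1+b≡q))
    where
    only-white : ∀ w′ → w′ ∉ S → G u w′ → SameWhiteComp G S w w′ → w′ ≡ w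
    only-white w′ w′∉S adj _ = suc∣p∩q∣≡∣q∣⇒unique-∉ 1+b≡q w∈Q w∉S (P-neighbour u∈P adj) w′∉S

  force-from-P⇒counts : ∀ {S u w} → PSDForce G S u w → u ∈ P →
    ForcingCounts (∣ P ∣) (∣ Q ∣) (∣ S ∩ P ∣) (∣ S ∩ Q ∣)
  force-from-P⇒counts {S} {u} {w} (u∈S , w∉S , adj , only-white) u∈P with ∣ S ∩ P ∣ ≟ ∣ P ∣
  ... | yes a≡p = left-full a≡p
  ... | no  a≢p with ∣p∩q∣<∣q∣⇒∃∈q∉p (≤∧≢⇒< (∣p∩q∣≤∣q∣ S P) a≢p)
  ... | x , x∈P , x∉S =
    -- w, the white x ∈ P and any white y ∈ Q lie in one white component, so y = w.
    right-almost-full (unique-∉⇒suc∣p∩q∣≡∣q∣ w∈Q w∉S unique) (x∈p⇒0<∣p∣ (x∈p∩q⁺ (u∈S , u∈P)))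
    where
    w∈Q : w ∈ Q
    w∈Q = P-neighbour u∈P adj
    unique : ∀ {y} → y ∈ Q → y ∉ S → y ≡ w
    unique y∈Q y∉S = only-white _ y∉S (P→Q-edge u∈P y∈Q)
      (there w∉S (Q→P-edge w∈Q x∈P) (there x∉S (P→Q-edge x∈P y∈Q) (here y∉S)))

module CompleteBipartite {n} {G : Graph n} {P Q : Subset n} (bip : IsCompleteBipartite G P Q)
  {p q} (∣P∣≡p : ∣ P ∣ ≡ p) (∣Q∣≡q : ∣ Q ∣ ≡ q) (0<p : 0 < p) (0<q : 0 < q) where

  open IsCompleteBipartite bip
  private
    module Left  = OneSide bip
    module Right = OneSide (IsCompleteBipartite-swap bip)

  forcing⇒counts : ∀ {S} → IsPSDForcingSet G S → ForcingCounts p q (∣ S ∩ P ∣) (∣ S ∩ Q ∣)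
  forcing⇒counts {S} = subst₂ (λ p q → ForcingCounts p q _ _) ∣P∣≡p ∣Q∣≡q ∘ counts
    where
    counts : IsPSDForcingSet G S → ForcingCounts (∣ P ∣) (∣ Q ∣) (∣ S ∩ P ∣) (∣ S ∩ Q ∣)
    counts (done all-blue) = left-full (q⊆p⇒∣p∩q∣≡∣q∣ λ {x} _ → all-blue x)
    counts (step u _ force _) with partition u
    ... | inj₁ u∈P = Left.force-from-P⇒counts force u∈P
    ... | inj₂ u∈Q = ForcingCounts-swap (Right.force-from-P⇒counts force u∈Q)

  counts⇒forcing : ∀ {S} → ForcingCounts p q (∣ S ∩ P ∣) (∣ S ∩ Q ∣) → IsPSDForcingSet G S
  counts⇒forcing = forcing ∘ subst₂ (λ p q → ForcingCounts p q _ _) (sym ∣P∣≡p) (sym ∣Q∣≡q)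
    where
    P-full⇒forcing : ∀ {S} → ∣ S ∩ P ∣ ≡ ∣ P ∣ → IsPSDForcingSet G S
    P-full⇒forcing = Left.left-full⇒forcing (0<∣p∣⇒Nonempty (subst (0 <_) (sym ∣P∣≡p) 0<p))
    Q-full⇒forcing : ∀ {S} → ∣ S ∩ Q ∣ ≡ ∣ Q ∣ → IsPSDForcingSet G S
    Q-full⇒forcing = Right.left-full⇒forcing (0<∣p∣⇒Nonempty (subst (0 <_) (sym ∣Q∣≡q) 0<q))
    forcing : ∀ {S} → ForcingCounts (∣ P ∣) (∣ Q ∣) (∣ S ∩ P ∣) (∣ S ∩ Q ∣) → IsPSDForcingSet G S
    forcing (left-full a≡p)               = P-full⇒forcing a≡p
    forcing (right-full b≡q)              = Q-full⇒forcing b≡q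
    forcing (right-almost-full 1+b≡q 0<a) = Left.right-almost-full⇒forcing Q-full⇒forcing 1+b≡q 0<a
    forcing (left-almost-full 1+a≡p 0<b)  = Right.right-almost-full⇒forcing P-full⇒forcing 1+a≡p 0<b

  ∣S∩P∣<p : ∀ {S v} → v ∈ P → v ∉ S → ∣ S ∩ P ∣ < p
  ∣S∩P∣<p v∈P v∉S = subst (_ <_) ∣P∣≡p (x∈q∉p⇒∣p∩q∣<∣q∣ v∈P v∉S)

  ∣S∩Q∣<q : ∀ {S v} → v ∈ Q → v ∉ S → ∣ S ∩ Q ∣ < q
  ∣S∩Q∣<q v∈Q v∉S = subst (_ <_) ∣Q∣≡q (x∈q∉p⇒∣p∩q∣<∣q∣ v∈Q v∉S)

  Flip⇒CountStep : ∀ {S T} → Flip S T →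
    CountStep p q (∣ S ∩ P ∣) (∣ S ∩ Q ∣) (∣ T ∩ P ∣) (∣ T ∩ Q ∣)
  Flip⇒CountStep {S} (add {v} v∉S) with partition v
  ... | inj₁ v∈P = CountStep-cast refl refl
    (sym (∣p[x]≔inside∩q∣ v∈P v∉S)) (sym (∣p[x]≔b∩q∣ S inside (disjoint v∈P))) (addˡ (∣S∩P∣<p v∈P v∉S))
  ... | inj₂ v∈Q = CountStep-cast refl refl
    (sym (∣p[x]≔b∩q∣ S inside (disjoint′ v∈Q))) (sym (∣p[x]≔inside∩q∣ v∈Q v∉S)) (addʳ (∣S∩Q∣<q v∈Q v∉S))
  Flip⇒CountStep {S} (remove {v} v∈S) with partition v
  ... | inj₁ v∈P = CountStep-cast
    (∣p[x]≔outside∩q∣ v∈P v∈S) (∣p[x]≔b∩q∣ S outside (disjoint v∈P)) refl refl dropˡ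
  ... | inj₂ v∈Q = CountStep-cast
    (∣p[x]≔b∩q∣ S outside (disjoint′ v∈Q)) (∣p[x]≔outside∩q∣ v∈Q v∈S) refl refl dropʳ

  CountStep⇒Flip : ∀ {S a b a′ b′} → CountStep p q a b a′ b′ → ∣ S ∩ P ∣ ≡ a → ∣ S ∩ Q ∣ ≡ b →
    ∃ λ T → Flip S T × ∣ T ∩ P ∣ ≡ a′ × ∣ T ∩ Q ∣ ≡ b′
  CountStep⇒Flip {S} (addˡ a<p) refl refl with ∣p∩q∣<∣q∣⇒∃∈q∉p (subst (_ <_) (sym ∣P∣≡p) a<p)
  ... | v , v∈P , v∉S = _ , add v∉S , ∣p[x]≔inside∩q∣ v∈P v∉S , ∣p[x]≔b∩q∣ S inside (disjoint v∈P)
  CountStep⇒Flip {S} (addʳ b<q) refl refl with ∣p∩q∣<∣q∣⇒∃∈q∉p (subst (_ <_) (sym ∣Q∣≡q) b<q)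
  ... | v , v∈Q , v∉S = _ , add v∉S , ∣p[x]≔b∩q∣ S inside (disjoint′ v∈Q) , ∣p[x]≔inside∩q∣ v∈Q v∉S
  CountStep⇒Flip {S} dropˡ a≡1+a′ refl with 0<∣p∣⇒Nonempty (subst (0 <_) (sym a≡1+a′) (s≤s z≤n))
  ... | v , v∈S∩P with x∈p∩q⁻ S P v∈S∩P
  ... | v∈S , v∈P = _ , remove v∈S , suc-injective (trans (∣p[x]≔outside∩q∣ v∈P v∈S) a≡1+a′) ,
                    ∣p[x]≔b∩q∣ S outside (disjoint v∈P)
  CountStep⇒Flip {S} dropʳ refl b≡1+b′ with 0<∣p∣⇒Nonempty (subst (0 <_) (sym b≡1+b′) (s≤s z≤n))
  ... | v , v∈S∩Q with x∈p∩q⁻ S Q v∈S∩Q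
  ... | v∈S , v∈Q = _ , remove v∈S , ∣p[x]≔b∩q∣ S outside (disjoint′ v∈Q) ,
                    suc-injective (trans (∣p[x]≔outside∩q∣ v∈Q v∈S) b≡1+b′)

  counts-of-P : ∣ P ∩ P ∣ ≡ p × ∣ P ∩ Q ∣ ≡ 0
  counts-of-P = trans (q⊆p⇒∣p∩q∣≡∣q∣ {q = P} {p = P} λ x∈P → x∈P) ∣P∣≡p , ⊆P⇒∣S∩Q∣≡0 λ x∈P → x∈P

  counts-of-Q : ∣ Q ∩ P ∣ ≡ 0 × ∣ Q ∩ Q ∣ ≡ q
  counts-of-Q = ⊆Q⇒∣S∩P∣≡0 (λ x∈Q → x∈Q) , trans (q⊆p⇒∣p∩q∣≡∣q∣ {q = Q} {p = Q} λ x∈Q → x∈Q) ∣Q∣≡q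

  counts⇒≡P : ∀ {S} → ∣ S ∩ P ∣ ≡ p → ∣ S ∩ Q ∣ ≡ 0 → S ≡ P
  counts⇒≡P {S} a≡p b≡0 = ⊆-antisym S⊆P (∣p∩q∣≡∣q∣⇒q⊆p (trans a≡p (sym ∣P∣≡p)))
    where
    S⊆P : S ⊆ P
    S⊆P {x} x∈S with partition x
    ... | inj₁ x∈P = x∈P
    ... | inj₂ x∈Q = contradiction (subst (0 <_) b≡0 (x∈p⇒0<∣p∣ (x∈p∩q⁺ (x∈S , x∈Q)))) λ ()

  P-forcing : IsPSDForcingSet G P
  P-forcing = counts⇒forcing (left-full (proj₁ counts-of-P))

  Q-forcing : IsPSDForcingSet G Q
  Q-forcing = counts⇒forcing (right-full (proj₂ counts-of-Q))

  realise : ∀ {a b} → a ≤ p → b ≤ q → ∃ λ S → ∣ S ∩ P ∣ ≡ a × ∣ S ∩ Q ∣ ≡ b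
  realise {zero} {zero} _ _ = ⊥ , ∣⊥∩q∣≡0 P , ∣⊥∩q∣≡0 Q
    where
    ∣⊥∩q∣≡0 : ∀ R → ∣ ⊥ ∩ R ∣ ≡ 0
    ∣⊥∩q∣≡0 R = trans (cong ∣_∣ (∩-zeroˡ R)) (∣⊥∣≡0 n)
  realise {suc a} a<p b≤q with realise (<⇒≤ a<p) b≤q
  ... | S , a≡ , b≡ with CountStep⇒Flip {S} (addˡ a<p) a≡ b≡
  ... | T , _ , a′≡ , b′≡ = T , a′≡ , b′≡
  realise {zero} {suc b} 0≤p b<q with realise 0≤p (<⇒≤ b<q)
  ... | S , a≡ , b≡ with CountStep⇒Flip {S} (addʳ b<q) a≡ b≡
  ... | T , _ , a′≡ , b′≡ = T , a′≡ , b′≡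

  counts⇒TARInvariant : ∀ {k I} → CountInvariant p q k I → TARInvariant G k (λ S → I (∣ S ∩ P ∣) (∣ S ∩ Q ∣))
  counts⇒TARInvariant {k} inv {S} {T} adj fS ∣S∣≤k fT ∣T∣≤k =
    inv (Flip⇒CountStep (TARAdj⇒Flip G adj))
      (forcing⇒counts fS) (subst (_≤ k) (∣S∣≡∣S∩P∣+∣S∩Q∣ S) ∣S∣≤k)
      (forcing⇒counts fT) (subst (_≤ k) (∣S∣≡∣S∩P∣+∣S∩Q∣ T) ∣T∣≤k)

  p≤∣forcing∣ : p ≤ q → ∀ {S} → IsPSDForcingSet G S → p ≤ ∣ S ∣
  p≤∣forcing∣ p≤q {S} fS =
    subst (p ≤_) (sym (∣S∣≡∣S∩P∣+∣S∩Q∣ S)) (ForcingCounts⇒p≤a+b p≤q (forcing⇒counts fS))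

  Z₊≡p : p ≤ q → ZPlusIs G p
  Z₊≡p p≤q = (P , P-forcing , ∣P∣≡p) , λ { _ (S , fS , refl) → p≤∣forcing∣ p≤q fS }

  Q-minimal : 2 ≤ p → IsMinimalPSDForcingSet G Q
  Q-minimal 2≤p = Q-forcing , λ T T⊂Q@(T⊆Q , _) fT →
    ¬ForcingCounts-left-empty 2≤p (∣T∩Q∣<q T⊂Q)
      (subst (λ a → ForcingCounts p q a _) (⊆Q⇒∣S∩P∣≡0 T⊆Q) (forcing⇒counts fT))
    where
    ∣T∩Q∣<q : ∀ {T} → T ⊂ Q → ∣ T ∩ Q ∣ < q
    ∣T∩Q∣<q {T} T⊂Q = ≤-<-trans (∣p∩q∣≤∣p∣ T Q) (subst (∣ T ∣ <_) ∣Q∣≡q (p⊂q⇒∣p∣<∣q∣ T⊂Q))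

  minimal⇒¬removable : ∀ {S a b a′ b′} → IsMinimalPSDForcingSet G S →
    CountStep p q a b a′ b′ → ∣ S ∩ P ∣ ≡ a → ∣ S ∩ Q ∣ ≡ b → a′ + b′ < a + b → ¬ ForcingCounts p q a′ b′
  minimal⇒¬removable {S} (_ , minimal) count-step a≡ b≡ shrinks fc with CountStep⇒Flip count-step a≡ b≡
  ... | T , flip , a′≡ , b′≡ =
    minimal T (Flip-shrinks⇒⊂ flip ∣T∣<∣S∣) (counts⇒forcing (subst₂ (ForcingCounts p q) (sym a′≡) (sym b′≡) fc))
    where
    ∣T∣<∣S∣ : ∣ T ∣ < ∣ S ∣
    ∣T∣<∣S∣ = subst₂ _<_ (sym (trans (∣S∣≡∣S∩P∣+∣S∩Q∣ T) (cong₂ _+_ a′≡ b′≡)))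
                       (sym (trans (∣S∣≡∣S∩P∣+∣S∩Q∣ S) (cong₂ _+_ a≡ b≡))) shrinks

  minimal⇒≤q : p ≤ q → ∀ {S} → IsMinimalPSDForcingSet G S → ∣ S ∣ ≤ q
  minimal⇒≤q p≤q {S} minS@(fS , _) with ∣ S ∣ ≤? q
  ... | yes ∣S∣≤q = ∣S∣≤q
  ... | no  ∣S∣≰q
    with ForcingCounts-removable p≤q (subst (q <_) (∣S∣≡∣S∩P∣+∣S∩Q∣ S) (≰⇒> ∣S∣≰q)) (forcing⇒counts fS)
  ...   | inj₁ (a′ , a≡1+a′ , fc) = contradiction fc (minimal⇒¬removable minS dropˡ a≡1+a′ refl (n<1+n _))
  ...   | inj₂ (b′ , b≡1+b′ , fc) =
    contradiction fc
      (minimal⇒¬removable minS dropʳ refl b≡1+b′ (subst (∣ S ∩ P ∣ + b′ <_) (sym (+-suc _ b′)) (n<1+n _)))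

  Z̄₊≡q : 2 ≤ p → p ≤ q → ZPlusBarIs G q
  Z̄₊≡q 2≤p p≤q = (Q , Q-minimal 2≤p , ∣Q∣≡q) , λ { _ (S , minS , refl) → minimal⇒≤q p≤q minS }

  module _ {k} (p≤k : p ≤ k) (shrinkable : Shrinkable p q k) where

    count-step-path : ∀ {S R a b a′ b′} → CountStep p q a b a′ b′ → ∣ S ∩ P ∣ ≡ a → ∣ S ∩ Q ∣ ≡ b →
      ForcingCounts p q a′ b′ → a′ + b′ ≤ k →
      (∀ {T} → ∣ T ∩ P ∣ ≡ a′ → ∣ T ∩ Q ∣ ≡ b′ → TARPath G k T R) → TARPath G k S R
    count-step-path {S} count-step a≡ b≡ fc a′+b′≤k continue with CountStep⇒Flip {S} count-step a≡ b≡
    ... | T , flip , a′≡ , b′≡ =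
      move (Flip⇒TARAdj G flip)
        (counts⇒forcing (subst₂ (ForcingCounts p q) (sym a′≡) (sym b′≡) fc))
        (subst (_≤ k) (sym (trans (∣S∣≡∣S∩P∣+∣S∩Q∣ T) (cong₂ _+_ a′≡ b′≡))) a′+b′≤k)
        (continue a′≡ b′≡)

    full-P-path-to-P : ∀ b {S} → ∣ S ∩ P ∣ ≡ p → ∣ S ∩ Q ∣ ≡ b → p + b ≤ k → TARPath G k S P
    full-P-path-to-P zero    a≡p b≡0 _ = subst (TARPath G k _) (counts⇒≡P a≡p b≡0) stop
    full-P-path-to-P (suc b) a≡p b≡  p+b+1≤k = count-step-path dropʳ a≡p b≡ (left-full refl) p+b≤k
      λ a′≡ b′≡ → full-P-path-to-P b a′≡ b′≡ p+b≤k
      where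
      p+b≤k : p + b ≤ k
      p+b≤k = ≤-trans (+-monoʳ-≤ p (n≤1+n b)) p+b+1≤k

    extend-in-P : ∀ {S R a b} → a < p → ∣ S ∩ P ∣ ≡ a → ∣ S ∩ Q ∣ ≡ b → ForcingCounts p q a b → a + b ≤ k →
      (∀ {T b′} → ∣ T ∩ P ∣ ≡ suc a → ∣ T ∩ Q ∣ ≡ b′ → ForcingCounts p q (suc a) b′ → suc a + b′ ≤ k →
        TARPath G k T R) →
      TARPath G k S R
    extend-in-P {a = a} {b} a<p a≡ b≡ fc a+b≤k continue with suc (a + b) ≤? k
    ... | yes a+b<k = count-step-path (addˡ a<p) a≡ b≡ fc′ a+b<k λ a′≡ b′≡ → continue a′≡ b′≡ fc′ a+b<k
      where fc′ = ForcingCounts-suc-left a<p fc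
    ... | no  a+b≮k with shrinkable a<p (≤-antisym a+b≤k (≮⇒≥ a+b≮k)) fc
    ...   | b′ , refl , fc′ =
      count-step-path dropʳ a≡ b≡ fc′ (≤-trans (n≤1+n _) a+b′<k) λ a₁≡ b₁≡ →
      count-step-path (addˡ a<p) a₁≡ b₁≡ fc″ a+b′<k λ a₂≡ b₂≡ → continue a₂≡ b₂≡ fc″ a+b′<k
      where
      fc″ = ForcingCounts-suc-left a<p fc′
      a+b′<k : suc (a + b′) ≤ k
      a+b′<k = subst (_≤ k) (+-suc a b′) a+b≤k

    path-to-P : ∀ m {S a b} → m + a ≡ p → ∣ S ∩ P ∣ ≡ a → ∣ S ∩ Q ∣ ≡ b →
      ForcingCounts p q a b → a + b ≤ k → TARPath G k S P
    path-to-P zero    refl      a≡ b≡ _  a+b≤k = full-P-path-to-P _ a≡ b≡ a+b≤k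
    path-to-P (suc m) {a = a} m+a≡p a≡ b≡ fc a+b≤k =
      extend-in-P (subst (a <_) m+a≡p (s≤s (m≤n+m a m))) a≡ b≡ fc a+b≤k
        (path-to-P m (trans (+-suc m a) m+a≡p))

    TARConnected-if-shrinkable : TARConnected G k
    TARConnected-if-shrinkable =
      hub⇒TARConnected G P-forcing (subst (_≤ k) (sym ∣P∣≡p) p≤k) λ {S} fS ∣S∣≤k →
        path-to-P (p ∸ ∣ S ∩ P ∣) (m∸n+n≡m (subst (∣ S ∩ P ∣ ≤_) ∣P∣≡p (∣p∩q∣≤∣q∣ S P))) refl refl
          (forcing⇒counts fS) (subst (_≤ k) (∣S∣≡∣S∩P∣+∣S∩Q∣ S) ∣S∣≤k)

  ¬TARConnected-at-p : 2 ≤ q → ¬ TARConnected G p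
  ¬TARConnected-at-p 2≤q with realise {p ∸ 1} {1} (m∸n≤m p 1) (≤-trans (s≤s z≤n) 2≤q)
  ... | T , a≡p∸1 , b≡1 =
    TARInvariant⇒¬TARConnected G {S = P} {T = T} (counts⇒TARInvariant (left-full-invariant 2≤q ≤-refl))
      P-forcing (≤-reflexive ∣P∣≡p) (proj₁ counts-of-P)
      (counts⇒forcing
        (subst₂ (ForcingCounts p q) (sym a≡p∸1) (sym b≡1) (left-almost-full 1+[p∸1]≡p (s≤s z≤n))))
      (≤-reflexive (trans (∣S∣≡∣S∩P∣+∣S∩Q∣ T) (trans (cong₂ _+_ a≡p∸1 b≡1) (m∸n+n≡m 0<p))))
      (λ a≡p → <-irrefl (trans (sym a≡p∸1) a≡p) (≤-reflexive 1+[p∸1]≡p))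
    where
    1+[p∸1]≡p : suc (p ∸ 1) ≡ p
    1+[p∸1]≡p = m+[n∸m]≡n 0<p

  ¬TARConnected-at-q : 2 ≤ p → p ≤ q → ¬ TARConnected G q
  ¬TARConnected-at-q 2≤p p≤q =
    TARInvariant⇒¬TARConnected G (counts⇒TARInvariant (left-empty-invariant 2≤p ≤-refl))
      Q-forcing (≤-reflexive ∣Q∣≡q) (proj₁ counts-of-Q)
      P-forcing (subst (_≤ q) (sym ∣P∣≡p) p≤q)
      (λ a≡0 → contradiction (subst (2 ≤_) (trans (sym (proj₁ counts-of-P)) a≡0) 2≤p) λ ())

  ¬TARConnected-at-most-p+q-3 : ∀ {k} → 3 + k ≤ p + q → p ≤ k → q ≤ k → ¬ TARConnected G k
  ¬TARConnected-at-most-p+q-3 {k} 3+k≤p+q p≤k q≤k =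
    TARInvariant⇒¬TARConnected G (counts⇒TARInvariant (left-almost-full-invariant 3+k≤p+q))
      P-forcing (subst (_≤ k) (sym ∣P∣≡p) p≤k) (subst (λ a → p ≤ suc a) (sym (proj₁ counts-of-P)) (n≤1+n p))
      Q-forcing (subst (_≤ k) (sym ∣Q∣≡q) q≤k)
      (λ p≤1+a → 1+n≰n (≤-trans (n≤1+n _) (≤-pred
        (≤-trans 3+k≤p+q (+-mono-≤ (subst (λ a → p ≤ suc a) (proj₁ counts-of-Q) p≤1+a) q≤k)))))

  ¬TARConnected-below-p : p ≤ q → ∀ {k} → k < p → ¬ TARConnected G k
  ¬TARConnected-below-p p≤q k<p ((_ , fS , ∣S∣≤k) , _) = <⇒≱ k<p (≤-trans (p≤∣forcing∣ p≤q fS) ∣S∣≤k)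

-- The graph K p q

left : ∀ p q → Subset (p + q)
left p q = ⊤ {p} ++ ⊥ {q}

∈left⇒<p : ∀ {p q} {x : Fin (p + q)} → x ∈ left p q → toℕ x < p
∈left⇒<p {zero}  x∈⊥            = contradiction x∈⊥ ∉⊥
∈left⇒<p {suc p} {x = zero}  _  = s≤s z≤n
∈left⇒<p {suc p} {x = suc x} (there x∈left) = s≤s (∈left⇒<p x∈left)

<p⇒∈left : ∀ {p q} {x : Fin (p + q)} → toℕ x < p → x ∈ left p q
<p⇒∈left {suc p} {x = zero}  _        = here
<p⇒∈left {suc p} {x = suc x} (s≤s x<p) = there (<p⇒∈left x<p)

∣left∣ : ∀ p q → ∣ left p q ∣ ≡ p
∣left∣ zero    q = ∣⊥∣≡0 q
∣left∣ (suc p) q = cong suc (∣left∣ p q)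

∣∁left∣ : ∀ p q → ∣ ∁ (left p q) ∣ ≡ q
∣∁left∣ p q = trans (∣∁p∣≡n∸∣p∣ (left p q)) (trans (cong (p + q ∸_) (∣left∣ p q)) (m+n∸m≡n p q))

K-isCompleteBipartite : ∀ p q → IsCompleteBipartite (K p q) (left p q) (∁ (left p q))
K-isCompleteBipartite p q = record
  { partition     = partition
  ; disjoint      = x∈p⇒x∉∁p
  ; P→Q-edge      = λ x∈P y∈Q → inj₁ (∈left⇒<p x∈P , p≤ y∈Q)
  ; Q→P-edge      = λ x∈Q y∈P → inj₂ (p≤ x∈Q , ∈left⇒<p y∈P)
  ; P-independent = λ where
      x∈P y∈P (inj₁ (_ , p≤y)) → <⇒≱ (∈left⇒<p y∈P) p≤y
      x∈P y∈P (inj₂ (p≤x , _)) → <⇒≱ (∈left⇒<p x∈P) p≤x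
  ; Q-independent = λ where
      x∈Q y∈Q (inj₁ (x<p , _)) → <⇒≱ x<p (p≤ x∈Q)
      x∈Q y∈Q (inj₂ (_ , y<p)) → <⇒≱ y<p (p≤ y∈Q)
  }
  where
  p≤ : ∀ {x} → x ∈ ∁ (left p q) → p ≤ toℕ x
  p≤ x∈Q = ≮⇒≥ λ x<p → x∈∁p⇒x∉p x∈Q (<p⇒∈left x<p)
  partition : ∀ x → x ∈ left p q ⊎ x ∈ ∁ (left p q)
  partition x with toℕ x <? p
  ... | yes x<p = inj₁ (<p⇒∈left x<p)
  ... | no  x≮p = inj₂ (x∉p⇒x∈∁p λ x∈P → x≮p (∈left⇒<p x∈P))

module K-bipartite {p q} (0<p : 0 < p) (0<q : 0 < q) =
  CompleteBipartite (K-isCompleteBipartite p q) (∣left∣ p q) (∣∁left∣ p q) 0<p 0<q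

Z₊-Z̄₊ : ∀ p q → 2 ≤ p → p ≤ q → ZPlusIs (K p q) p × ZPlusBarIs (K p q) q
Z₊-Z̄₊ p q 2≤p p≤q = Z₊≡p p≤q , Z̄₊≡q 2≤p p≤q
  where open K-bipartite (≤-trans (s≤s z≤n) 2≤p) (≤-trans (s≤s z≤n) (≤-trans 2≤p p≤q))

z₀ : ∀ p q → 3 ≤ p → p ≤ q → Z0Is (K p q) (p + q ∸ 2)
z₀ (suc (suc zero)) _ (s≤s (s≤s ())) _
z₀ p@(suc (suc (suc r))) q _ p≤q =
  Z0Is-suc (K p q) connected (¬TARConnected-at-most-p+q-3 ≤-refl (≤-trans p≤q q≤r+q) q≤r+q)
  where
  open K-bipartite (s≤s z≤n) (≤-trans (s≤s z≤n) p≤q)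
  q≤r+q = m≤n+m q r
  connected : ∀ k → suc (r + q) ≤ k → TARConnected (K p q) k
  connected k r+q<k = TARConnected-if-shrinkable
    (≤-trans p≤q (≤-trans q≤r+q (≤-trans (n≤1+n _) r+q<k)))
    (shrinkable p≤q (≤-trans (s≤s (s≤s (s≤s z≤n))) p≤q) (≤-trans (s≤s q≤r+q) r+q<k) (s≤s (s≤s r+q<k)))

z₀-square : ∀ p → 4 ≤ p → Z0Is (K p p) (2 * p ∸ 2) × ZPlusBarIs (K p p) p
  × 2 * p ∸ 2 ≡ p + p ∸ 2 × p + 1 < 2 * p ∸ 2
z₀-square p 4≤p =
  subst (Z0Is (K p p)) (sym 2p∸2≡p+p∸2) (z₀ p p (≤-trans (n≤1+n 3) 4≤p) ≤-refl) ,
  proj₂ (Z₊-Z̄₊ p p (≤-trans (s≤s (s≤s z≤n)) 4≤p) ≤-refl) ,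
  2p∸2≡p+p∸2 ,
  subst (p + 1 <_) (sym (trans 2p∸2≡p+p∸2 (+-∸-assoc p 2≤p))) (+-monoʳ-< p (m+n≤o⇒m≤o∸n 2 4≤p))
  where
  2≤p : 2 ≤ p
  2≤p = ≤-trans (s≤s (s≤s z≤n)) 4≤p
  2p∸2≡p+p∸2 : 2 * p ∸ 2 ≡ p + p ∸ 2
  2p∸2≡p+p∸2 = cong (λ m → p + m ∸ 2) (+-identityʳ p)

z₀-K₂ : ∀ q → 4 ≤ q → UnderZ0Is (K 2 q) 3 × Z0Is (K 2 q) (q + 1)
  × q + 1 ≡ 3 + q ∸ 2 × 3 < q + 1
z₀-K₂ q 4≤q =
  UnderZ0Is-intro (K 2 q) (TARConnected-if-shrinkable (n≤1+n 2) (shrinkable-2-3 4≤q)) ¬connected-below-3 ,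
  subst (Z0Is (K 2 q)) (+-comm 1 q) (Z0Is-suc (K 2 q) connected (¬TARConnected-at-q ≤-refl 2≤q)) ,
  +-comm q 1 ,
  ≤-trans 4≤q (m≤m+n q 1)
  where
  2≤q = ≤-trans (s≤s (s≤s z≤n)) 4≤q
  open K-bipartite (s≤s z≤n) (≤-trans (s≤s z≤n) 2≤q)
  ¬connected-below-3 : ∀ {k} → k < 3 → ¬ TARConnected (K 2 q) k
  ¬connected-below-3 {zero}    _ = ¬TARConnected-below-p 2≤q (s≤s z≤n)
  ¬connected-below-3 {suc zero} _ = ¬TARConnected-below-p 2≤q ≤-refl
  ¬connected-below-3 {suc (suc zero)} _ = ¬TARConnected-at-p 2≤q
  ¬connected-below-3 {suc (suc (suc _))} (s≤s (s≤s (s≤s ())))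
  connected : ∀ k → suc q ≤ k → TARConnected (K 2 q) k
  connected k q<k = TARConnected-if-shrinkable (≤-trans 2≤q (≤-trans (n≤1+n q) q<k))
    (shrinkable 2≤q (≤-trans (n≤1+n 3) 4≤q) q<k (s≤s (s≤s (≤-trans (n≤1+n q) q<k))))

proposition4p7 :
    (∀ p q → 2 ≤ p → p ≤ q → ZPlusIs (K p q) p × ZPlusBarIs (K p q) q)
    × (∀ p q → 3 ≤ p → p ≤ q → Z0Is (K p q) (p + q ∸ 2))
    × (∀ p → 4 ≤ p → Z0Is (K p p) (2 * p ∸ 2) × ZPlusBarIs (K p p) p
         × 2 * p ∸ 2 ≡ p + p ∸ 2 × p + 1 < 2 * p ∸ 2)
    × (∀ q → 4 ≤ q → UnderZ0Is (K 2 q) 3 × Z0Is (K 2 q) (q + 1)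
         × q + 1 ≡ 3 + q ∸ 2 × 3 < q + 1)
proposition4p7 = Z₊-Z̄₊ , z₀ , z₀-square , z₀-K₂
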